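{- Let $G$ be a connected finite simple plane graph containing no $4$-cycle adjacent to a $3$-cycle (sharing at least one edge), such that $G$ is not DP-$4$-colorable but every proper subgraph of $G$ is DP-$4$-colorable. Let $v$ be a vertex of degree $d(v)\ge 5$. Then (1) $v$ is incident to at most $\lfloor d(v)/2\rfloor$ $3$-faces; and (2) if $v$ is incident to exactly $t$ $3$-faces and $2t<d(v)$, then $v$ is incident to at most $t-1$ special $5$-faces.
   Context: DP-$4$-colorability: $G$ is DP-$4$-colorable if for every list assignment $L$ with $|L(v)|\ge 4$ and every choice of matchings $M_{L,uv}$ between $\{u\}\times L(u)$ and $\{v\}\times L(v)$ for edges $uv$, the cover graph (vertex set $\{(u,c):c\in L(u)\}$, each $\{u\}\times L(u)$ a clique, cross edges given by the matchings) has an independent set of size $|V(G)|$. A $k$-face is a face of boundary length $k$; two faces are adjacent if they share at least one edge. A special $5$-face is a $5$-face $f$ having exactly one vertex of degree at least $5$ and four vertices of degree $4$, such that each of the five faces sharing an edge with $f$ (one across each edge of $f$) is a $3$-face. -}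

module Defs where

open import Data.Nat using (ℕ; zero; suc; _+_; _*_; _≤_; _<_; _∸_; ⌊_/2⌋; _≡ᵇ_; _≤ᵇ_)
open import Data.Fin using (Fin; _≟_)
import Data.Fin as F
open import Data.Bool using (Bool; true; false; if_then_else_; _∧_; _∨_; not)
open import Data.Product using (Σ; ∃; _×_; _,_)
open import Data.Sum using (_⊎_)
open import Data.Empty using (⊥)
open import Relation.Nullary using (¬_; does)
open import Relation.Binary.PropositionalEquality using (_≡_; _≢_)
open import Relation.Binary.Construct.Closure.ReflexiveTransitive using (Star)

iter : ∀ {A : Set} → (A → A) → ℕ → A → A
iter f zero    x = x
iter f (suc i) x = f (iter f i x)

count : ∀ {n} → (Fin n → Bool) → ℕ
count {zero}  p = 0
count {suc n} p = (if p F.zero then 1 else 0) + count (λ i → p (F.suc i))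

anyFin : ∀ {n} → (Fin n → Bool) → Bool
anyFin {zero}  p = false
anyFin {suc n} p = p F.zero ∨ anyFin (λ i → p (F.suc i))

allFin? : ∀ {n} → (Fin n → Bool) → Bool
allFin? {zero}  p = true
allFin? {suc n} p = p F.zero ∧ allFin? (λ i → p (F.suc i))

_==_ : ∀ {n} → Fin n → Fin n → Bool
a == b = does (a ≟ b)

_⇒ᵇ_ : Bool → Bool → Bool
a ⇒ᵇ b = not a ∨ b

-- The list L(u) is represented by a set of s u ≥ 4 colours, Fin (s u).
-- M u v is the matching between {u}×L(u) and {v}×L(v) (used for edges uv);
-- it is a (partial) matching and symmetric in (u,v).
-- An independent set of size |V| in the cover, whose fibres {u}×L(u) are
-- cliques, is exactly one colour φ u ∈ L(u) per vertex u with no matching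
-- edge between (u, φ u) and (v, φ v) for uv ∈ E.

record Cover {V : Set} (E : V → V → Set) (s : V → ℕ) : Set₁ where
  field
    M      : (u v : V) → Fin (s u) → Fin (s v) → Set
    M-sym  : ∀ u v i j → M u v i j → M v u j i
    M-fun  : ∀ u v i j j' → M u v i j → M u v i j' → j ≡ j'
    M-inj  : ∀ u v i i' j → M u v i j → M u v i' j → i ≡ i'

DP4Colorable : (V : Set) → (E : V → V → Set) → Set₁
DP4Colorable V E =
  (s : V → ℕ) → (∀ v → 4 ≤ s v) → (C : Cover E s) →
  Σ ((u : V) → Fin (s u)) λ φ →
    ∀ u v → E u v → ¬ Cover.M C u v (φ u) (φ v)

-- Connected finite simple plane graphs, as combinatorial maps
-- (rotation systems) of Euler characteristic 2.
--   darts  : Fin nD, α = reversal involution, σ = rotation around vertex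
--   vertices = σ-orbits (labelled by vert : Fin nD → Fin nV)
--   edges    = α-orbits (nD = 2|E|)
--   faces    = orbits of φ = σ ∘ α (labelled by face : Fin nD → Fin nF)
-- A dart d goes from vert d to vert (α d).

record PlaneGraph : Set where
  field
    nD nV nF : ℕ
    α σ σ⁻   : Fin nD → Fin nD
    α-invol  : ∀ d → α (α d) ≡ d
    α-free   : ∀ d → α d ≢ d
    σ-left   : ∀ d → σ⁻ (σ d) ≡ d
    σ-right  : ∀ d → σ (σ⁻ d) ≡ d
    vert     : Fin nD → Fin nV
    vert-σ   : ∀ d → vert (σ d) ≡ vert d
    vert-orb : ∀ d d' → vert d ≡ vert d' → ∃ λ i → iter σ i d ≡ d'
    vert-sur : ∀ v → ∃ λ d → vert d ≡ v
    face     : Fin nD → Fin nF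
    face-φ   : ∀ d → face (σ (α d)) ≡ face d
    face-orb : ∀ d d' → face d ≡ face d' → ∃ λ i → iter (λ x → σ (α x)) i d ≡ d'
    face-sur : ∀ f → ∃ λ d → face d ≡ f
    no-loop  : ∀ d → vert (α d) ≢ vert d
    no-multi : ∀ d d' → vert d ≡ vert d' → vert (α d) ≡ vert (α d') → d ≡ d'

  Adj : Fin nV → Fin nV → Set
  Adj u w = ∃ λ d → vert d ≡ u × vert (α d) ≡ w

  field
    connected : ∀ u w → Star Adj u w
    -- Euler's formula V - E + F = 2 with E = nD/2 (genus 0, i.e. planar)
    euler     : 2 * nV + 2 * nF ≡ nD + 4

  deg : Fin nV → ℕ
  deg v = count (λ d → vert d == v)

  len : Fin nF → ℕ
  len f = count (λ d → face d == f)

  incident : Fin nV → Fin nF → Bool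
  incident v f = anyFin (λ d → (vert d == v) ∧ (face d == f))

  special5 : Fin nF → Bool
  special5 f =
    (len f ≡ᵇ 5)
    ∧ (count (λ d → (face d == f) ∧ (5 ≤ᵇ deg (vert d))) ≡ᵇ 1)
    ∧ (count (λ d → (face d == f) ∧ (deg (vert d) ≡ᵇ 4)) ≡ᵇ 4)
    ∧ allFin? (λ d → (face d == f) ⇒ᵇ (len (face (α d)) ≡ᵇ 3))

  num3faces : Fin nV → ℕ
  num3faces v = count (λ f → (len f ≡ᵇ 3) ∧ incident v f)

  numSpecial5 : Fin nV → ℕ
  numSpecial5 v = count (λ f → special5 f ∧ incident v f)

  NoC4AdjC3 : Set
  NoC4AdjC3 = ¬ (Σ (Fin nV) λ a → Σ (Fin nV) λ b → Σ (Fin nV) λ c →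
                  Σ (Fin nV) λ d → Σ (Fin nV) λ x →
                    a ≢ c × b ≢ d ×
                    Adj a b × Adj b c × Adj c d × Adj d a ×
                    Adj b x × Adj x a)

  DP4 : Set₁
  DP4 = DP4Colorable (Fin nV) Adj

  record Subgraph : Set where
    field
      P     : Fin nV → Bool
      Q     : Fin nV → Fin nV → Bool
      Q-sym : ∀ u w → Q u w ≡ true → Q w u ≡ true
      Q-adj : ∀ u w → Q u w ≡ true → Adj u w
      Q-end : ∀ u w → Q u w ≡ true → P u ≡ true
    Proper : Set
    Proper = (∃ λ v → P v ≡ false) ⊎ (∃ λ u → ∃ λ w → Adj u w × Q u w ≡ false)
    Vert : Set
    Vert = Σ (Fin nV) λ v → P v ≡ true
    Edge : Vert → Vert → Set
    Edge (u , _) (w , _) = Q u w ≡ true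
    DP4Sub : Set₁
    DP4Sub = DP4Colorable Vert Edge

-- Call the darts at v its corners, cyclically ordered by the rotation σ, and call a corner
-- a 3-face corner when its face is a 3-face; a 3-face has exactly one corner at each of
-- its vertices, so v lies on as many 3-faces as it has 3-face corners. Two consecutive
-- 3-face corners would give triangles v x₁ x₂ and v x₂ x₃, hence the 4-cycle v x₁ x₂ x₃
-- sharing the edge v x₁ with the triangle v x₁ x₂. So σ maps 3-face corners injectively
-- to the other corners, which gives (1). A corner on a special 5-face is flanked by
-- 3-face corners on both sides, so σ maps special corners injectively to 3-face corners,
-- missing every 3-face corner y whose predecessor σ⁻ y is not special. If there is no
-- such y, the 3-face corners are closed under σ⁻², so at least every other corner is a
-- 3-face corner and deg v ≤ 2t.
module Submission where

open import Defs
open import Data.Nat using (ℕ; zero; suc; _+_; _*_; _∸_; _≤_; _<_; z≤n; s≤s; ⌊_/2⌋; _≡ᵇ_; _≤ᵇ_)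
open import Data.Nat.Properties
  using (≤-trans; ≤-antisym; <⇒≱; n<1+n; +-monoʳ-≤; +-identityʳ; +-suc;
         ⌊n/2⌋-mono; n≡⌊n+n/2⌋; ≡ᵇ⇒≡; ≡⇒≡ᵇ; module ≤-Reasoning)
open import Data.Fin using (Fin; _≟_)
import Data.Fin as F
open import Data.Fin.Properties using (suc-injective; 0≢1+n; any?)
open import Data.Bool using (Bool; true; false; T; _∧_; not; if_then_else_)
open import Data.Bool.Properties using (T?; ∧-identityʳ)
open import Data.List using (List; []; _∷_; length)
open import Data.List.Relation.Unary.All using (All; []; _∷_)
import Data.List.Relation.Unary.All as All
open import Data.List.Relation.Unary.Any using (here; there; index)
open import Data.List.Relation.Unary.AllPairs using ([]; _∷_)
open import Data.List.Relation.Unary.Unique.Propositional using (Unique)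
open import Data.List.Membership.Propositional using (_∈_)
open import Data.List.Membership.Setoid.Properties using (index-injective)
open import Data.Product using (∃; _×_; _,_; proj₁; proj₂)
open import Data.Sum using (_⊎_; inj₁; inj₂; [_,_])
open import Data.Unit using (tt)
open import Data.Empty using (⊥; ⊥-elim)
open import Function using (_∘_)
open import Relation.Nullary using (¬_; yes; no)
open import Relation.Binary.PropositionalEquality
  using (_≡_; _≢_; refl; sym; trans; cong; cong₂; subst; subst₂; setoid; module ≡-Reasoning)

module _ {n : ℕ} where

  ==⇒≡ : {a b : Fin n} → T (a == b) → a ≡ b
  ==⇒≡ {a} {b} h with a ≟ b
  ... | yes a≡b = a≡b

  ≡⇒== : {a b : Fin n} → a ≡ b → T (a == b)
  ≡⇒== {a} {b} a≡b with a ≟ b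
  ... | yes _  = tt
  ... | no a≢b = a≢b a≡b

  ≢⇒not== : {a b : Fin n} → a ≢ b → T (not (a == b))
  ≢⇒not== {a} {b} a≢b with a ≟ b
  ... | yes a≡b = a≢b a≡b
  ... | no _    = tt

T-∧⁺ : ∀ {a b} → T a → T b → T (a ∧ b)
T-∧⁺ {true} _ tb = tb

T-∧ˡ : ∀ {a b} → T (a ∧ b) → T a
T-∧ˡ {true} _ = tt

T-∧ʳ : ∀ a {b} → T (a ∧ b) → T b
T-∧ʳ true tb = tb

T-not⁺ : ∀ {a} → ¬ T a → T (not a)
T-not⁺ {false} _  = tt
T-not⁺ {true}  ¬a = ¬a tt

T-not⁻ : ∀ {a} → T (not a) → ¬ T a
T-not⁻ {false} _ ()

T-⇒ᵇ : ∀ {a b} → T a → T (a ⇒ᵇ b) → T b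
T-⇒ᵇ {true} _ tb = tb

anyFin⁺ : ∀ {n} (p : Fin n → Bool) i → T (p i) → T (anyFin p)
anyFin⁺ p F.zero    pi with p F.zero
... | true = tt
anyFin⁺ p (F.suc i) pi with p F.zero
... | true  = tt
... | false = anyFin⁺ (p ∘ F.suc) i pi

anyFin⁻ : ∀ {n} (p : Fin n → Bool) → T (anyFin p) → ∃ λ i → T (p i)
anyFin⁻ {suc n} p h with p F.zero in p0
... | true  = F.zero , subst T (sym p0) tt
... | false = let i , pi = anyFin⁻ (p ∘ F.suc) h in F.suc i , pi

allFin?⁻ : ∀ {n} (p : Fin n → Bool) → T (allFin? p) → ∀ i → T (p i)
allFin?⁻ {suc n} p h i with p F.zero in p0
allFin?⁻ {suc n} p h F.zero    | true = subst T (sym p0) tt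
allFin?⁻ {suc n} p h (F.suc i) | true = allFin?⁻ (p ∘ F.suc) h i

_without_ : ∀ {n} → (Fin n → Bool) → Fin n → Fin n → Bool
(p without y) j = p j ∧ not (j == y)

T-without : ∀ {n} (p : Fin n → Bool) {x y} → T (p x) → x ≢ y → T ((p without y) x)
T-without p px x≢y = T-∧⁺ px (≢⇒not== x≢y)

count-cong : ∀ {n} {p q : Fin n → Bool} → (∀ i → p i ≡ q i) → count p ≡ count q
count-cong {zero}  p≗q = refl
count-cong {suc n} p≗q =
  cong₂ _+_ (cong (λ b → if b then 1 else 0) (p≗q F.zero)) (count-cong (p≗q ∘ F.suc))

count-const-true : ∀ k → count {k} (λ _ → true) ≡ k
count-const-true zero    = refl
count-const-true (suc k) = cong suc (count-const-true k)

count-without : ∀ {n} (p : Fin n → Bool) y → T (p y) → count p ≡ suc (count (p without y))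
count-without p F.zero py with p F.zero
... | true = cong suc (count-cong {p = p ∘ F.suc} (λ i → sym (∧-identityʳ _)))
count-without p (F.suc y) py with p F.zero
... | true  = cong suc (count-without (p ∘ F.suc) y py)
... | false = count-without (p ∘ F.suc) y py

count-≤-injection : ∀ {m n} (p : Fin m → Bool) (q : Fin n → Bool)
  (g : ∀ i → T (p i) → Fin n) → (∀ i pi → T (q (g i pi))) →
  (∀ i j pi pj → g i pi ≡ g j pj → i ≡ j) → count p ≤ count q
count-≤-injection {zero}  p q g g∈q g-inj = z≤n
count-≤-injection {suc m} p q g g∈q g-inj with p F.zero in p0
... | false = count-≤-injection (p ∘ F.suc) q (g ∘ F.suc) (g∈q ∘ F.suc)
                (λ i j pi pj → suc-injective ∘ g-inj _ _ pi pj)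
... | true  = subst (suc (count (p ∘ F.suc)) ≤_) (sym (count-without q y (g∈q F.zero pz)))
                (s≤s (count-≤-injection (p ∘ F.suc) (q without y) (g ∘ F.suc)
                  (λ i pi → T-without q (g∈q (F.suc i) pi) (0≢1+n ∘ sym ∘ g-inj _ _ pi pz))
                  (λ i j pi pj → suc-injective ∘ g-inj _ _ pi pj)))
  where
  pz = subst T (sym p0) tt
  y  = g F.zero pz

count-split : ∀ {n} (p q : Fin n → Bool) →
  count p ≡ count (λ i → p i ∧ q i) + count (λ i → p i ∧ not (q i))
count-split {zero}  p q = refl
count-split {suc n} p q with p F.zero | q F.zero
... | false | _     = count-split (p ∘ F.suc) (q ∘ F.suc)
... | true  | true  = cong suc (count-split (p ∘ F.suc) (q ∘ F.suc))
... | true  | false = trans (cong suc (count-split (p ∘ F.suc) (q ∘ F.suc))) (sym (+-suc _ _))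

count-none : ∀ {n} (p : Fin n → Bool) → (∀ i → ¬ T (p i)) → count p ≡ 0
count-none {zero}  p none = refl
count-none {suc n} p none with p F.zero in p0
... | false = count-none (p ∘ F.suc) (none ∘ F.suc)
... | true  = ⊥-elim (none F.zero (subst T (sym p0) tt))

count-≤-length : ∀ {n} (p : Fin n → Bool) (xs : List (Fin n)) →
  (∀ i → T (p i) → i ∈ xs) → count p ≤ length xs
count-≤-length p xs p⊆xs =
  subst (count p ≤_) (count-const-true (length xs))
    (count-≤-injection p (λ _ → true) (λ i pi → index (p⊆xs i pi)) (λ _ _ → tt)
      (λ i j pi pj → index-injective (setoid _) (p⊆xs i pi) (p⊆xs j pj)))

length-≤-count : ∀ {n} (p : Fin n → Bool) (xs : List (Fin n)) →
  Unique xs → All (T ∘ p) xs → length xs ≤ count p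
length-≤-count p []       _            _          = z≤n
length-≤-count p (x ∷ xs) (x∉xs ∷ uxs) (px ∷ pxs) =
  subst (suc (length xs) ≤_) (sym (count-without p x px))
    (s≤s (length-≤-count (p without x) xs uxs
      (All.zipWith (λ (py , x≢y) → T-without p py (x≢y ∘ sym)) (pxs , x∉xs))))

iter-suc : ∀ {A : Set} (f : A → A) i x → iter f (suc i) x ≡ iter f i (f x)
iter-suc f zero    x = refl
iter-suc f (suc i) x = cong f (iter-suc f i x)

iter-inverse : ∀ {A : Set} (f g : A → A) → (∀ x → g (f x) ≡ x) → ∀ i x → iter g i (iter f i x) ≡ x
iter-inverse f g g∘f zero    x = refl
iter-inverse f g g∘f (suc i) x = begin
  iter g (suc i) (f (iter f i x))  ≡⟨ iter-suc g i _ ⟩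
  iter g i (g (f (iter f i x)))    ≡⟨ cong (iter g i) (g∘f _) ⟩
  iter g i (iter f i x)            ≡⟨ iter-inverse f g g∘f i x ⟩
  x                                ∎
  where open ≡-Reasoning

iter-∈ : ∀ {A : Set} (f : A → A) {xs : List A} → (∀ {y} → y ∈ xs → f y ∈ xs) →
  ∀ {x} → x ∈ xs → ∀ i → iter f i x ∈ xs
iter-∈ f closed x∈xs zero    = x∈xs
iter-∈ f closed x∈xs (suc i) = closed (iter-∈ f closed x∈xs i)

iter-∈-period2 : ∀ {A : Set} (f : A → A) x → f (f x) ≡ x → ∀ i → iter f i x ∈ x ∷ f x ∷ []
iter-∈-period2 f x ffx≡x = iter-∈ f closed (here refl)
  where
  closed : ∀ {y} → y ∈ x ∷ f x ∷ [] → f y ∈ x ∷ f x ∷ []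
  closed (here refl)         = there (here refl)
  closed (there (here refl)) = here ffx≡x

iter-∈-period3 : ∀ {A : Set} (f : A → A) x → f (f (f x)) ≡ x →
  ∀ i → iter f i x ∈ x ∷ f x ∷ f (f x) ∷ []
iter-∈-period3 f x fffx≡x = iter-∈ f closed (here refl)
  where
  closed : ∀ {y} → y ∈ x ∷ f x ∷ f (f x) ∷ [] → f y ∈ x ∷ f x ∷ f (f x) ∷ []
  closed (here refl)                 = there (here refl)
  closed (there (here refl))         = there (there (here refl))
  closed (there (there (here refl))) = here fffx≡x

iter-alternates : ∀ {A : Set} (f : A → A) (P : A → Set) → (∀ y → P y → P (f (f y))) →
  ∀ {x} → P x → ∀ i → P (iter f i x) ⊎ P (iter f (suc i) x)
iter-alternates f P closed px zero    = inj₁ px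
iter-alternates f P closed px (suc i) =
  [ inj₂ ∘ closed _ , inj₁ ] (iter-alternates f P closed px i)

module PlaneGraphProperties (G : PlaneGraph) where
  open PlaneGraph G

  φ : Fin nD → Fin nD
  φ d = σ (α d)

  σ-injective : ∀ {x y} → σ x ≡ σ y → x ≡ y
  σ-injective {x} {y} e = trans (sym (σ-left x)) (trans (cong σ⁻ e) (σ-left y))

  σ⁻-injective : ∀ {x y} → σ⁻ x ≡ σ⁻ y → x ≡ y
  σ⁻-injective {x} {y} e = trans (sym (σ-right x)) (trans (cong σ e) (σ-right y))

  α-injective : ∀ {x y} → α x ≡ α y → x ≡ y
  α-injective {x} {y} e = trans (sym (α-invol x)) (trans (cong α e) (α-invol y))

  φ-injective : ∀ {x y} → φ x ≡ φ y → x ≡ y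
  φ-injective = α-injective ∘ σ-injective

  vert-σ⁻ : ∀ d → vert (σ⁻ d) ≡ vert d
  vert-σ⁻ d = trans (sym (vert-σ (σ⁻ d))) (cong vert (σ-right d))

  vert-φ : ∀ d → vert (φ d) ≡ vert (α d)
  vert-φ d = vert-σ (α d)

  vert-φ-≢ : ∀ d → vert (φ d) ≢ vert d
  vert-φ-≢ d = no-loop d ∘ trans (sym (vert-φ d))

  φ-≢ : ∀ d → φ d ≢ d
  φ-≢ d = vert-φ-≢ d ∘ cong vert

  vert-orb⁻ : ∀ d d' → vert d ≡ vert d' → ∃ λ i → iter σ⁻ i d ≡ d'
  vert-orb⁻ d d' same with vert-orb d' d (sym same)
  ... | i , σⁱd'≡d = i , trans (cong (iter σ⁻ i) (sym σⁱd'≡d)) (iter-inverse σ σ⁻ σ-left i d')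

  face-σ : ∀ d → face (σ d) ≡ face (α d)
  face-σ d = trans (cong (face ∘ σ) (sym (α-invol d))) (face-φ (α d))

  face-ασ⁻ : ∀ d → face (α (σ⁻ d)) ≡ face d
  face-ασ⁻ d = trans (sym (face-φ (α (σ⁻ d)))) (cong face (trans (cong σ (α-invol (σ⁻ d))) (σ-right d)))

  Adj-sym : ∀ {u w} → Adj u w → Adj w u
  Adj-sym (d , refl , refl) = α d , refl , cong vert (α-invol d)

  Adj-α : ∀ d → Adj (vert d) (vert (α d))
  Adj-α d = d , refl , refl

  Adj-φ : ∀ d → Adj (vert d) (vert (φ d))
  Adj-φ d = subst (Adj (vert d)) (sym (vert-φ d)) (Adj-α d)

  deg≤2 : ∀ e → σ (σ e) ≡ e → deg (vert e) ≤ 2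
  deg≤2 e σσe≡e = count-≤-length (λ d → vert d == vert e) (e ∷ σ e ∷ [])
    (λ d d∼e → let i , σⁱe≡d = vert-orb e d (sym (==⇒≡ d∼e)) in
               subst (_∈ _) σⁱe≡d (iter-∈-period2 σ e σσe≡e i))

  len≤2 : ∀ d → φ (φ d) ≡ d → len (face d) ≤ 2
  len≤2 d φφd≡d = count-≤-length (λ d' → face d' == face d) (d ∷ φ d ∷ [])
    (λ d' d'∼d → let i , φⁱd≡d' = face-orb d d' (sym (==⇒≡ d'∼d)) in
                 subst (_∈ _) φⁱd≡d' (iter-∈-period2 φ d φφd≡d i))

  face-iter-φ : ∀ i d → face (iter φ i d) ≡ face d
  face-iter-φ zero    d = refl
  face-iter-φ (suc i) d = trans (face-φ _) (face-iter-φ i d)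

  4≤len : ∀ d → φ (φ d) ≢ d → φ (φ (φ d)) ≢ d → 4 ≤ len (face d)
  4≤len d φ²d≢d φ³d≢d =
    length-≤-count (λ d' → face d' == face d) (d ∷ φ d ∷ φ (φ d) ∷ φ (φ (φ d)) ∷ [])
    ( (φ-≢ d ∘ sym ∷ φ²d≢d ∘ sym ∷ φ³d≢d ∘ sym ∷ [])
    ∷ (φ-≢ (φ d) ∘ sym ∷ φ²d≢d ∘ sym ∘ φ-injective ∷ [])
    ∷ (φ-≢ (φ (φ d)) ∘ sym ∷ [])
    ∷ [] ∷ [])
    (on-face 0 ∷ on-face 1 ∷ on-face 2 ∷ on-face 3 ∷ [])
    where
    on-face : ∀ i → T (face (iter φ i d) == face d)
    on-face i = ≡⇒== (face-iter-φ i d)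

  φ³≡id-on-3-face : ∀ d → len (face d) ≡ 3 → φ (φ (φ d)) ≡ d
  φ³≡id-on-3-face d len≡3 with φ (φ d) ≟ d | φ (φ (φ d)) ≟ d
  ... | yes φ²d≡d | _         =
    ⊥-elim (<⇒≱ (n<1+n 2) (subst (_≤ 2) len≡3 (len≤2 d φ²d≡d)))
  ... | no _      | yes φ³d≡d = φ³d≡d
  ... | no φ²d≢d  | no φ³d≢d  =
    ⊥-elim (<⇒≱ (n<1+n 3) (subst (4 ≤_) len≡3 (4≤len d φ²d≢d φ³d≢d)))

  3-face-corner-unique : ∀ d d' → len (face d) ≡ 3 → vert d ≡ vert d' → face d ≡ face d' → d ≡ d'
  3-face-corner-unique d d' len≡3 same-vert same-face
    with face-orb d d' same-face
  ... | i , φⁱd≡d' with subst (_∈ _) φⁱd≡d' (iter-∈-period3 φ d (φ³≡id-on-3-face d len≡3) i)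
  ...   | here d'≡d                 = sym d'≡d
  ...   | there (here refl)         = ⊥-elim (vert-φ-≢ d (sym same-vert))
  ...   | there (there (here refl)) =
    ⊥-elim (vert-φ-≢ (φ (φ d)) (trans (cong vert (φ³≡id-on-3-face d len≡3)) same-vert))

  -- In a triangle with corner e, the third vertex is the head of the dart σ⁻ e.
  φ²≡ασ⁻-on-3-face : ∀ e → φ (φ (φ e)) ≡ e → φ (φ e) ≡ α (σ⁻ e)
  φ²≡ασ⁻-on-3-face e φ³e≡e =
    trans (sym (α-invol _)) (cong α (trans (sym (σ-left _)) (cong σ⁻ φ³e≡e)))

  3-face-Adj : ∀ e → len (face e) ≡ 3 → Adj (vert (α e)) (vert (α (σ⁻ e)))
  3-face-Adj e len≡3 =
    subst₂ Adj (vert-φ e) (cong vert (φ²≡ασ⁻-on-3-face e (φ³≡id-on-3-face e len≡3))) (Adj-φ (φ e))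

  no-consecutive-3-faces : NoC4AdjC3 → ∀ e → 2 < deg (vert e) →
    len (face e) ≡ 3 → len (face (σ e)) ≡ 3 → ⊥
  no-consecutive-3-faces noC e 2<deg 3-face 3-face′ =
    noC ( v , x₁ , x₂ , x₃ , x₂ , v≢x₂ , x₁≢x₃
        , v∼x₁ , x₁∼x₂ , x₂∼x₃ , x₃∼v , x₁∼x₂ , Adj-sym (Adj-α e))
    where
    v  = vert e
    x₁ = vert (α (σ⁻ e))
    x₂ = vert (α e)
    x₃ = vert (α (σ e))
    v∼x₁ : Adj v x₁
    v∼x₁ = subst (λ u → Adj u x₁) (vert-σ⁻ e) (Adj-α (σ⁻ e))
    x₁∼x₂ : Adj x₁ x₂
    x₁∼x₂ = Adj-sym (3-face-Adj e 3-face)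
    x₂∼x₃ : Adj x₂ x₃
    x₂∼x₃ = Adj-sym (subst (λ d → Adj x₃ (vert (α d))) (σ-left e) (3-face-Adj (σ e) 3-face′))
    x₃∼v : Adj x₃ v
    x₃∼v = Adj-sym (subst (λ u → Adj u x₃) (vert-σ e) (Adj-α (σ e)))
    v≢x₂ : v ≢ x₂
    v≢x₂ = no-loop e ∘ sym
    x₁≢x₃ : x₁ ≢ x₃
    x₁≢x₃ same-head = <⇒≱ 2<deg (deg≤2 e (trans (cong σ (sym σ⁻e≡σe)) (σ-right e)))
      where
      σ⁻e≡σe = no-multi (σ⁻ e) (σ e) (trans (vert-σ⁻ e) (sym (vert-σ e))) same-head

  special5-sides : ∀ d → T (special5 (face d)) → ∀ d' → face d' ≡ face d → len (face (α d')) ≡ 3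
  special5-sides d special d' on-face = ≡ᵇ⇒≡ _ 3 (T-⇒ᵇ (≡⇒== on-face) (allFin?⁻ _ sides d'))
    where
    sides = T-∧ʳ (count (λ d″ → (face d″ == face d) ∧ (deg (vert d″) ≡ᵇ 4)) ≡ᵇ 4)
              (T-∧ʳ (count (λ d″ → (face d″ == face d) ∧ (5 ≤ᵇ deg (vert d″))) ≡ᵇ 1)
                (T-∧ʳ (len (face d) ≡ᵇ 5) special))

  special5-flanked : ∀ e → T (special5 (face e)) → len (face (σ e)) ≡ 3 × len (face (σ⁻ e)) ≡ 3
  special5-flanked e special =
      trans (cong len (face-σ e)) (special5-sides e special e refl)
    , subst (λ d → len (face d) ≡ 3) (α-invol (σ⁻ e)) (special5-sides e special (α (σ⁻ e)) (face-ασ⁻ e))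

  module Corners (v : Fin nV) where

    at : Fin nD → Bool
    at d = vert d == v

    3-face-corner : Fin nD → Bool
    3-face-corner d = at d ∧ (len (face d) ≡ᵇ 3)

    other-corner : Fin nD → Bool
    other-corner d = at d ∧ not (len (face d) ≡ᵇ 3)

    special-corner : Fin nD → Bool
    special-corner d = at d ∧ special5 (face d)

    T-at-σ : ∀ {d} → T (at d) → T (at (σ d))
    T-at-σ {d} = subst T (cong (_== v) (sym (vert-σ d)))

    T-at-σ⁻ : ∀ {d} → T (at d) → T (at (σ⁻ d))
    T-at-σ⁻ {d} = subst T (cong (_== v) (sym (vert-σ⁻ d)))

    T-3-face-corner⁺ : ∀ {d} → T (at d) → len (face d) ≡ 3 → T (3-face-corner d)
    T-3-face-corner⁺ {d} at-d len≡3 = T-∧⁺ at-d (≡⇒≡ᵇ _ 3 len≡3)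

    len-3-face-corner : ∀ d → T (3-face-corner d) → len (face d) ≡ 3
    len-3-face-corner d h = ≡ᵇ⇒≡ _ 3 (T-∧ʳ (at d) h)

    deg≡3-face+other : deg v ≡ count 3-face-corner + count other-corner
    deg≡3-face+other = count-split at (λ d → len (face d) ≡ᵇ 3)

    faces≤corners : (P : Fin nF → Bool) →
      count (λ f → P f ∧ incident v f) ≤ count (λ d → at d ∧ P (face d))
    faces≤corners P = count-≤-injection _ _ (λ f h → proj₁ (corner f h))
      (λ f h → let d , at-d∧on-f = corner f h in
               T-∧⁺ (T-∧ˡ at-d∧on-f) (subst (T ∘ P) (sym (==⇒≡ (T-∧ʳ _ at-d∧on-f))) (T-∧ˡ h)))
      (λ f f′ h h′ d≡d′ → trans (sym (==⇒≡ (T-∧ʳ _ (proj₂ (corner f h)))))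
                            (trans (cong face d≡d′) (==⇒≡ (T-∧ʳ _ (proj₂ (corner f′ h′))))))
      where
      corner : ∀ f → T (P f ∧ incident v f) → ∃ λ d → T (at d ∧ (face d == f))
      corner f h = anyFin⁻ _ (T-∧ʳ (P f) h)

    3-face-corners≤3-faces : count 3-face-corner ≤ num3faces v
    3-face-corners≤3-faces = count-≤-injection _ _ (λ d _ → face d)
      (λ d h → T-∧⁺ (T-∧ʳ (at d) h)
                 (anyFin⁺ (λ d′ → at d′ ∧ (face d′ == face d)) d
                   (T-∧⁺ (T-∧ˡ {at d} h) (≡⇒== {a = face d} refl))))
      (λ d d′ h h′ → 3-face-corner-unique d d′ (len-3-face-corner d h)
                       (trans (==⇒≡ (T-∧ˡ h)) (sym (==⇒≡ (T-∧ˡ h′)))))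

    num3faces≡3-face-corners : num3faces v ≡ count 3-face-corner
    num3faces≡3-face-corners =
      ≤-antisym (faces≤corners (λ f → len f ≡ᵇ 3)) 3-face-corners≤3-faces

    σ-special-corner : ∀ d → T (special-corner d) → T (3-face-corner (σ d))
    σ-special-corner d h =
      T-3-face-corner⁺ (T-at-σ (T-∧ˡ h)) (proj₁ (special5-flanked d (T-∧ʳ (at d) h)))

    special-corners≤3-face-corners : count special-corner ≤ count 3-face-corner
    special-corners≤3-face-corners =
      count-≤-injection _ _ (λ d _ → σ d) σ-special-corner (λ _ _ _ _ → σ-injective)

    special-corners<3-face-corners : ∀ y → T (3-face-corner y) → ¬ T (special-corner (σ⁻ y)) →
      count special-corner ≤ count 3-face-corner ∸ 1
    special-corners<3-face-corners y 3-face-y not-special =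
      subst (λ k → count special-corner ≤ k ∸ 1) (sym (count-without _ y 3-face-y))
        (count-≤-injection _ _ (λ d _ → σ d)
          (λ d h → T-without 3-face-corner (σ-special-corner d h)
                     (λ σd≡y → not-special (subst (T ∘ special-corner) (σ⁻-σ-≡ σd≡y) h)))
          (λ _ _ _ _ → σ-injective))
      where
      σ⁻-σ-≡ : ∀ {d} → σ d ≡ y → d ≡ σ⁻ y
      σ⁻-σ-≡ {d} σd≡y = trans (sym (σ-left d)) (cong σ⁻ σd≡y)

    other-corners≤3-face-corners : (∀ y → T (3-face-corner y) → T (special-corner (σ⁻ y))) →
      ∀ y → T (3-face-corner y) → count other-corner ≤ count 3-face-corner
    other-corners≤3-face-corners preceded y 3-face-y =
      count-≤-injection _ _ (λ d _ → σ⁻ d) σ⁻-other-corner (λ _ _ _ _ → σ⁻-injective)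
      where
      σ⁻²-closed : ∀ d → T (3-face-corner d) → T (3-face-corner (σ⁻ (σ⁻ d)))
      σ⁻²-closed d h = let special = preceded d h in
        T-3-face-corner⁺ (T-at-σ⁻ (T-∧ˡ special))
          (proj₂ (special5-flanked (σ⁻ d) (T-∧ʳ (at (σ⁻ d)) special)))
      σ⁻-other-corner : ∀ d → T (other-corner d) → T (3-face-corner (σ⁻ d))
      σ⁻-other-corner d h with vert-orb⁻ y d (trans (==⇒≡ (T-∧ˡ 3-face-y)) (sym (==⇒≡ (T-∧ˡ h))))
      ... | i , refl with iter-alternates σ⁻ (T ∘ 3-face-corner) σ⁻²-closed 3-face-y i
      ...   | inj₁ 3-face-d   = ⊥-elim (T-not⁻ (T-∧ʳ (at (iter σ⁻ i y)) h) (T-∧ʳ _ 3-face-d))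
      ...   | inj₂ 3-face-σ⁻d = 3-face-σ⁻d

    deg≤2*3-face-corners : (∀ y → T (3-face-corner y) → T (special-corner (σ⁻ y))) →
      ∀ y → T (3-face-corner y) → deg v ≤ 2 * count 3-face-corner
    deg≤2*3-face-corners preceded y 3-face-y = begin
      deg v                                     ≡⟨ deg≡3-face+other ⟩
      count 3-face-corner + count other-corner
        ≤⟨ +-monoʳ-≤ _ (other-corners≤3-face-corners preceded y 3-face-y) ⟩
      count 3-face-corner + count 3-face-corner ≡⟨ cong (count 3-face-corner +_) (sym (+-identityʳ _)) ⟩
      2 * count 3-face-corner                   ∎
      where open ≤-Reasoning

    special-corners≤3-face-corners∸1 : 2 * count 3-face-corner < deg v →
      count special-corner ≤ count 3-face-corner ∸ 1
    special-corners≤3-face-corners∸1 2t₃<deg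
      with any? (λ y → T? (3-face-corner y ∧ not (special-corner (σ⁻ y))))
    ... | yes (y , h) = special-corners<3-face-corners y (T-∧ˡ h) (T-not⁻ (T-∧ʳ (3-face-corner y) h))
    ... | no none with any? (T? ∘ 3-face-corner)
    ...   | yes (y , 3-face-y) = ⊥-elim (<⇒≱ 2t₃<deg (deg≤2*3-face-corners preceded y 3-face-y))
      where
      preceded : ∀ y → T (3-face-corner y) → T (special-corner (σ⁻ y))
      preceded y h with T? (special-corner (σ⁻ y))
      ... | yes special = special
      ... | no ¬special = ⊥-elim (none (y , T-∧⁺ h (T-not⁺ ¬special)))
    ...   | no no-3-face = subst (λ k → count special-corner ≤ k ∸ 1) (sym t₃≡0)
                             (subst (count special-corner ≤_) t₃≡0 special-corners≤3-face-corners)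
      where
      t₃≡0 = count-none 3-face-corner (λ y h → no-3-face (y , h))

    module _ (noC : NoC4AdjC3) (2<deg : 2 < deg v) where

      σ-3-face-corner : ∀ d → T (3-face-corner d) → T (other-corner (σ d))
      σ-3-face-corner d h = T-∧⁺ (T-at-σ (T-∧ˡ h)) (T-not⁺ (λ 3-face′ →
        no-consecutive-3-faces noC d (subst (λ u → 2 < deg u) (sym (==⇒≡ (T-∧ˡ h))) 2<deg)
          (len-3-face-corner d h) (≡ᵇ⇒≡ _ 3 3-face′)))

      3-face-corners≤other-corners : count 3-face-corner ≤ count other-corner
      3-face-corners≤other-corners =
        count-≤-injection _ _ (λ d _ → σ d) σ-3-face-corner (λ _ _ _ _ → σ-injective)

      3-face-corners≤⌊deg/2⌋ : count 3-face-corner ≤ ⌊ deg v /2⌋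
      3-face-corners≤⌊deg/2⌋ = begin
        t₃                  ≡⟨ n≡⌊n+n/2⌋ t₃ ⟩
        ⌊ t₃ + t₃ /2⌋       ≤⟨ ⌊n/2⌋-mono (subst (t₃ + t₃ ≤_) (sym deg≡3-face+other)
                                 (+-monoʳ-≤ t₃ 3-face-corners≤other-corners)) ⟩
        ⌊ deg v /2⌋         ∎
        where
        open ≤-Reasoning
        t₃ = count 3-face-corner

lemma3 : (G : PlaneGraph) → let open PlaneGraph G in
    NoC4AdjC3 →
    ¬ DP4 →
    ((H : Subgraph) → Subgraph.Proper H → Subgraph.DP4Sub H) →
    (v : Fin nV) → 5 ≤ deg v →
    (num3faces v ≤ ⌊ deg v /2⌋)
    × ((t : ℕ) → num3faces v ≡ t → 2 * t < deg v → numSpecial5 v ≤ t ∸ 1)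
lemma3 G noC _ _ v 5≤deg = at-most-half , specials-bound
  where
  open PlaneGraph G
  open PlaneGraphProperties G
  open Corners v

  2<deg : 2 < deg v
  2<deg = ≤-trans (s≤s (s≤s (s≤s z≤n))) 5≤deg

  at-most-half : num3faces v ≤ ⌊ deg v /2⌋
  at-most-half = subst (_≤ ⌊ deg v /2⌋) (sym num3faces≡3-face-corners) (3-face-corners≤⌊deg/2⌋ noC 2<deg)

  specials-bound : (t : ℕ) → num3faces v ≡ t → 2 * t < deg v → numSpecial5 v ≤ t ∸ 1
  specials-bound t num3faces≡t 2t<deg =
    ≤-trans (faces≤corners special5)
      (subst (λ k → count special-corner ≤ k ∸ 1) t₃≡t
        (special-corners≤3-face-corners∸1 (subst (λ k → 2 * k < deg v) (sym t₃≡t) 2t<deg)))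
    where
    t₃≡t = trans (sym num3faces≡3-face-corners) num3faces≡t
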